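{- Let $\Lambda$ be a normal greedoid over a finite alphabet $\Sigma$ which has the interval property, is optimistic, and satisfies $\kappa(F\sqcap F')=\kappa(F)\cap\kappa(F')$ for all flats $F,F'\in\Lambda/\mathord{\sim}$. Define $\rho^\natural:2^\Sigma\to\mathbb{Z}_{\ge 0}$ by $\rho^\natural(X)=\min\{r(F):F\in\Lambda/\mathord{\sim},\ \kappa(F)\supseteq X\}$. Then $\rho^\natural$ is a polymatroid rank function which is a representation of $\Lambda$, and the maps $\varphi^*=\sigma_{\rho^\natural}\circ\kappa:\mathcal{L}_\Lambda\to\mathcal{L}_{\rho^\natural}$ and $\varphi_*=\kappa^{ -1}:\mathcal{L}_{\rho^\natural}\to\mathcal{L}_\Lambda$ form a Galois insertion in which $\varphi^*$ preserves the covering relation of $\mathcal{L}_\Lambda$.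
   Context: Words: $\Sigma^*$ finite words over $\Sigma$; simple = no repeated letter; $\tilde\alpha$ the set of letters, $|\alpha|$ the length. A greedoid over $\Sigma$ is a nonempty language $\Lambda\subseteq\Sigma^*$ of simple words with (i) $\alpha\beta\in\Lambda\Rightarrow\alpha\in\Lambda$, (ii) if $\alpha,\beta\in\Lambda$, $|\alpha|>|\beta|$, then $\beta x\in\Lambda$ for some $x\in\tilde\alpha$. Basic words are feasible words of maximal length. Normal: every letter occurs in some word of $\Lambda$. Interval property: for all $\alpha,\beta\in\Lambda$ with $|\beta|>|\alpha|$ some nonempty subword $\beta'$ of $\beta$ (letters of $\beta$ kept in the same relative order) has $\alpha\beta'\in\Lambda$. Continuations $\Gamma[\alpha]=\{x:\alpha x\in\Lambda\}$. Optimistic: for every letter $y$ occurring in some feasible word and every basic word $x_1\cdots x_r$ there is an index $i$ with $y\in\Gamma[x_1\cdots x_i]$. Greedoid rank $r(X)=\max\{|\beta|:\beta\in\Lambda,\tilde\beta\subseteq X\}$, greedoid span $\sigma_r(X)=\{y:r(X\cup\{y\})=r(X)\}$, kernel $\kappa(X)=\bigcup\{\tilde\beta:\beta\in\Lambda,\tilde\beta\subseteq\sigma_r(X)\}$, $\kappa[\alpha]:=\kappa(\tilde\alpha)$. Flats: classes $[\alpha]$ of $\alpha\sim\beta\iff\Gamma[\alpha]=\Gamma[\beta]$, set $\Lambda/\mathord{\sim}$, ordered by $[\alpha]\sqsubset[\beta]$ iff some nonempty $\beta'$ has $\alpha\beta'\in\Lambda$, $\alpha\beta'\sim\beta$; for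 interval greedoids this is a lattice $\mathcal{L}_\Lambda$ with meet $\sqcap$ and covering relation $\prec$, $\kappa(F):=\kappa[\alpha]$ ($\alpha\in F$) is an order isomorphism from flats onto kernels under inclusion, $\kappa^{ -1}(X)$ is the unique flat $F$ with $\kappa(F)=\kappa(X)$, and $r(F):=|\alpha|$ for $\alpha\in F$. A polymatroid rank function is $\rho:2^\Sigma\to\mathbb{R}$ with $\rho(\emptyset)=0$, monotone, submodular; span $\sigma_\rho(X)=\{y:\rho(X\cup\{y\})=\rho(X)\}$; $\mathcal{L}_\rho$ is the lattice of closed sets ($X=\sigma_\rho(X)$) under inclusion. $\rho$ is a representation of $\Lambda$ if $\Lambda=\{x_1\cdots x_k:\rho(\{x_1,\dots,x_i\})=i\ \forall i\le k\}$. A Galois connection between posets $P,Q$ is a pair of order preserving maps $\varphi^*:P\to Q$, $\varphi_*:Q\to P$ with $\varphi^*(p)\le q\iff p\le\varphi_*(q)$; it is a Galois insertion if $\varphi^*\circ\varphi_*$ is the identity on $Q$. -}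

module Defs where

open import Data.Nat using (ℕ; zero; suc; _≤_; _<_; _⊔_; _⊓_; _+_; _≡ᵇ_)
open import Data.Bool using (Bool; true; false; T; _∧_; not)
open import Data.Fin using (Fin)
open import Data.List using (List; []; _∷_; _++_; _∷ʳ_; length; take; map; concatMap; filterᵇ; foldr; all; allFin)
open import Data.List.Relation.Unary.Unique.Propositional using (Unique)
open import Data.List.Relation.Binary.Sublist.Propositional using () renaming (_⊆_ to _⊑ˢ_)
import Data.List.Membership.Propositional as LM
open import Data.Fin.Subset using (Subset; ⊥; ⁅_⁆; _∪_; _∩_; _⊆_; _⊂_; ⋃)
open import Data.Fin.Subset.Properties using (_⊆?_)
open import Data.Vec using (lookup; tabulate)
open import Data.Vec.Base using ()
open import Data.Fin.Base using ()
open import Data.List.Base using ()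
open import Data.Product using (Σ; ∃; _×_; _,_)
open import Data.Sum using (_⊎_)
open import Relation.Nullary using (¬_; ⌊_⌋)
open import Relation.Binary.PropositionalEquality using (_≡_; _≢_)
import Data.Fin as F

-- A language is given by its (Boolean) characteristic function; since a
-- greedoid consists of simple words over a finite alphabet it is a finite
-- set, so this is no restriction.

Word : ℕ → Set
Word n = List (Fin n)

Language : ℕ → Set
Language n = Word n → Bool

letters : ∀ {n} → Word n → Subset n
letters = foldr (λ x s → ⁅ x ⁆ ∪ s) ⊥

wordsUpTo : ∀ {n} → ℕ → List (Word n)
wordsUpTo zero    = [] ∷ []
wordsUpTo {n} (suc k) = [] ∷ concatMap (λ x → map (x ∷_) (wordsUpTo k)) (allFin n)

_⊆ᵇ_ : ∀ {n} → Subset n → Subset n → Bool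
X ⊆ᵇ Y = ⌊ X ⊆? Y ⌋

module _ {n : ℕ} (Λ : Language n) where

  Feasible : Word n → Set
  Feasible w = T (Λ w)

  record IsGreedoid : Set where
    field
      nonempty    : ∃ λ w → Feasible w
      simple      : ∀ w → Feasible w → Unique w
      hereditary  : ∀ α β → Feasible (α ++ β) → Feasible α
      exchange    : ∀ α β → Feasible α → Feasible β → length β < length α →
                    ∃ λ x → x LM.∈ α × Feasible (β ∷ʳ x)

  IsNormal : Set
  IsNormal = ∀ (x : Fin n) → ∃ λ w → Feasible w × x LM.∈ w

  -- subword = letters kept in the same relative order (Sublist)
  HasIntervalProperty : Set
  HasIntervalProperty = ∀ α β → Feasible α → Feasible β → length α < length β →
    ∃ λ β′ → β′ ⊑ˢ β × β′ ≢ [] × Feasible (α ++ β′)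

  _∈Γ_ : Fin n → Word n → Set
  x ∈Γ α = Feasible (α ∷ʳ x)

  IsBasic : Word n → Set
  IsBasic b = Feasible b × (∀ w → Feasible w → length w ≤ length b)

  IsOptimistic : Set
  IsOptimistic = ∀ (y : Fin n) → (∃ λ w → Feasible w × y LM.∈ w) →
    ∀ b → IsBasic b → ∃ λ i → i ≤ length b × y ∈Γ take i b

  -- rank, span, kernel (computed by enumerating all words of length ≤ n,
  -- which contain all simple, hence all feasible, words)

  feasibleWords : List (Word n)
  feasibleWords = filterᵇ Λ (wordsUpTo n)

  rank : Subset n → ℕ
  rank X = foldr _⊔_ 0 (map length (filterᵇ (λ β → letters β ⊆ᵇ X) feasibleWords))

  spanR : Subset n → Subset n
  spanR X = tabulate λ y → rank (X ∪ ⁅ y ⁆) ≡ᵇ rank X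

  kernel : Subset n → Subset n
  kernel X = ⋃ (map letters (filterᵇ (λ β → letters β ⊆ᵇ spanR X) feasibleWords))

  κw : Word n → Subset n
  κw α = kernel (letters α)

  -- Flats: feasible words modulo α ∼ β ⟺ Γ[α] = Γ[β]

  _∼_ : Word n → Word n → Set
  α ∼ β = ∀ x → Λ (α ∷ʳ x) ≡ Λ (β ∷ʳ x)

  _⊏_ : Word n → Word n → Set
  α ⊏ β = ∃ λ β′ → β′ ≢ [] × Feasible (α ++ β′) × (α ++ β′) ∼ β

  _⊑_ : Word n → Word n → Set
  α ⊑ β = α ∼ β ⊎ α ⊏ β

  IsMeet : Word n → Word n → Word n → Set
  IsMeet γ α β = γ ⊑ α × γ ⊑ β ×
    (∀ δ → Feasible δ → δ ⊑ α → δ ⊑ β → δ ⊑ γ)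

  _≺_ : Word n → Word n → Set
  α ≺ β = α ⊏ β × ¬ (∃ λ δ → Feasible δ × α ⊏ δ × δ ⊏ β)

  KernelMeetProperty : Set
  KernelMeetProperty = ∀ α β γ → Feasible α → Feasible β → Feasible γ →
    IsMeet γ α β → κw γ ≡ κw α ∩ κw β

  -- ρ♮(X) = min{ r(F) : F flat, κ(F) ⊇ X } = min{ |α| : α ∈ Λ, X ⊆ κ[α] }
  -- (the minimum is taken with start value n; all feasible words are simple,
  -- hence of length ≤ n, and the set is nonempty for normal greedoids)

  ρ♮ : Subset n → ℕ
  ρ♮ X = foldr _⊓_ n (map length (filterᵇ (λ α → X ⊆ᵇ κw α) feasibleWords))

module _ {n : ℕ} (ρ : Subset n → ℕ) where

  record IsPolymatroidRank : Set where
    field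
      empty       : ρ ⊥ ≡ 0
      monotone    : ∀ X Y → X ⊆ Y → ρ X ≤ ρ Y
      submodular  : ∀ X Y → ρ (X ∪ Y) + ρ (X ∩ Y) ≤ ρ X + ρ Y

  spanρ : Subset n → Subset n
  spanρ X = tabulate λ y → ρ (X ∪ ⁅ y ⁆) ≡ᵇ ρ X

  IsClosed : Subset n → Set
  IsClosed X = spanρ X ≡ X

  _≺ρ_ : Subset n → Subset n → Set
  X ≺ρ Y = X ⊂ Y × ¬ (∃ λ Z → IsClosed Z × X ⊂ Z × Z ⊂ Y)

  Represents : Language n → Set
  Represents Λ = ∀ (w : Word n) →
    (Feasible Λ w → ∀ i → i ≤ length w → ρ (letters (take i w)) ≡ i) ×
    ((∀ i → i ≤ length w → ρ (letters (take i w)) ≡ i) → Feasible Λ w)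

-- The conclusion of Theorem 8.
-- φ*(F) = σ_ρ(κ(F)),  φ_*(X) = κ⁻¹(X) = the flat [γ] with κ[γ] = κ(X).

record Theorem8Conclusion {n : ℕ} (Λ : Language n) : Set where
  ρ : Subset n → ℕ
  ρ = ρ♮ Λ
  φ* : Word n → Subset n
  φ* α = spanρ ρ (κw Λ α)
  field
    polymatroid   : IsPolymatroidRank ρ
    representation : Represents ρ Λ
    φ*-closed     : ∀ α → Feasible Λ α → IsClosed ρ (φ* α)
    φ*-monotone   : ∀ α β → Feasible Λ α → Feasible Λ β → _⊑_ Λ α β → φ* α ⊆ φ* β
    φ_*-exists    : ∀ X → IsClosed ρ X → ∃ λ γ → Feasible Λ γ × κw Λ γ ≡ kernel Λ X
    φ_*-monotone  : ∀ X Y γ δ → IsClosed ρ X → IsClosed ρ Y → X ⊆ Y →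
                    Feasible Λ γ → κw Λ γ ≡ kernel Λ X →
                    Feasible Λ δ → κw Λ δ ≡ kernel Λ Y → _⊑_ Λ γ δ
    galois        : ∀ α X γ → Feasible Λ α → IsClosed ρ X →
                    Feasible Λ γ → κw Λ γ ≡ kernel Λ X →
                    (φ* α ⊆ X → _⊑_ Λ α γ) × (_⊑_ Λ α γ → φ* α ⊆ X)
    insertion     : ∀ X γ → IsClosed ρ X → Feasible Λ γ → κw Λ γ ≡ kernel Λ X →
                    φ* γ ≡ X
    covering      : ∀ α β → Feasible Λ α → Feasible Λ β → _≺_ Λ α β →
                    _≺ρ_ ρ (φ* α) (φ* β)

{-# OPTIONS --safe #-}
-- Under the kernel-meet property, κ is an order embedding of the flats: α ⊑ β iff κ[α] ⊆ κ[β]. (A word δ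
-- with δ̃ ⊆ κ[α] is spanned by α and augments to a word equivalent to α; conversely, if α ⊑ β then α is the
-- meet of α and β.) Thus ρ♮(X) is the rank of the least flat whose kernel contains X. For submodularity
-- take flats α, β realising ρ♮ X and ρ♮ Y: a basis γ of κ[α] ∩ κ[β] is their meet, so κ[γ] ⊇ X ∩ Y, and
-- extending γa ∼ α by letters of b, where γb ∼ β, to a basis gives a flat above α and β of rank at most
-- r(α) + r(β) − r(γ). The ρ♮-closed sets are exactly the kernels, so κ and κ⁻¹ are inverse order
-- isomorphisms between flats and closed sets; this gives the Galois insertion and the preservation of
-- covers. For the representation, ρ♮ is the length on feasible words; and if ρ♮ grows by one from p to
-- py, then y enters the kernel at a one-letter extension px of p, and optimism, applied to a basic
-- extension of px, forces py to be feasible.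
module Submission where

open import Defs
  hiding (Feasible; _∈Γ_; _∼_; _⊏_; _⊑_; _≺_; IsMeet; IsBasic; feasibleWords; rank; spanR; kernel; κw; ρ♮)
open import Data.Nat using (ℕ)

open import Data.Bool using (true; false; T)
open import Data.Bool.Properties using (T-≡)
open import Data.Empty using (⊥-elim)
open import Data.Fin using (Fin)
open import Data.Fin.Properties using (¬∀⟶∃¬)
open import Data.Fin.Subset using (Subset; ⁅_⁆; _∪_; _∩_; _⊆_; _⊂_; ⋃; _∈_; _∉_)
open import Data.Fin.Subset.Properties
  using (_∈?_; ⊆-refl; ⊆-antisym; p⊆p∪q; q⊆p∪q; p∩q⊆p; p∩q⊆q; x∈p∪q⁺; x∈p∪q⁻; x∈p∩q⁺; x∈p∩q⁻;
         x∈⁅x⁆; x∈⁅y⁆⇒x≡y; ∉⊥; ∈⊤)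
open import Data.List using (List; []; _∷_; _++_; _∷ʳ_; [_]; length; take; drop; map; foldr; filterᵇ)
open import Data.List.Properties
  using (length-++; length-++-sucʳ; length-++-≤ˡ; length-take; length-tabulate; ++-identityʳ; ∷ʳ-++;
         take++drop≡id; foldr-preservesᵒ)
open import Data.List.Membership.Propositional using () renaming (_∈_ to _∈ₗ_)
open import Data.List.Membership.Propositional.Properties
  using (∈-++⁻; ∈-++⁺ˡ; ∈-++⁺ʳ; ∈-∃++; ∈-filter⁺; ∈-filter⁻; ∈-concatMap⁺; ∈-map⁺; ∈-map⁻; ∈-allFin;
         foldr-selective)
open import Data.List.Relation.Binary.Disjoint.Propositional using (Disjoint)
open import Data.List.Relation.Binary.Subset.Propositional using () renaming (_⊆_ to _⊆ₗ_)
open import Data.List.Relation.Unary.All as All using ()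
open import Data.List.Relation.Unary.AllPairs using (_∷_)
open import Data.List.Relation.Unary.Any as Any using (here; there)
open import Data.List.Relation.Unary.Unique.Propositional using (Unique)
open import Data.Nat using (zero; suc; _≤_; _<_; _⊔_; _⊓_; _+_; _∸_; z≤n; s≤s)
open import Data.Nat.Properties
  using (module ≤-Reasoning; ≤-reflexive; ≤-trans; ≤-antisym; <-≤-trans; ≮⇒≥; n≮n; m<m+n; suc-injective;
         +-comm; +-assoc; +-suc; +-identityʳ; +-mono-≤; +-monoʳ-≤; m+[n∸m]≡n; n≤0⇒n≡0; m≤n⇒m⊓n≡m;
         m≤n⇒m≤n⊔o; m≤n⇒m≤o⊔n; m≤n⇒m⊓o≤n; m≤n⇒o⊓m≤n; ⊔-sel; ⊓-sel; ≡⇒≡ᵇ; ≡ᵇ⇒≡)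
open import Data.Product using (∃; _×_; _,_; proj₁; proj₂)
open import Data.Sum using (_⊎_; inj₁; inj₂; [_,_]′)
open import Data.Vec.Properties using (lookup∘tabulate; []=⇒lookup; lookup⇒[]=)
open import Function using (_∘_)
open import Function.Bundles using (Equivalence)
open import Relation.Binary.PropositionalEquality
  using (_≡_; refl; sym; trans; cong; cong₂; subst; subst₂; module ≡-Reasoning)
open import Relation.Nullary using (¬_)
open import Relation.Nullary.Decidable using (toWitness; fromWitness; T?; decidable-stable; _→-dec_)

module _ {a} {A : Set a} where

  Unique⇒length≤ : ∀ {xs ys : List A} → Unique xs → xs ⊆ₗ ys → length xs ≤ length ys
  Unique⇒length≤ {[]}     _            _     = z≤n
  Unique⇒length≤ {x ∷ xs} (x∉xs ∷ xs!) xs⊆ys with ∈-∃++ (xs⊆ys (here refl))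
  ... | us , vs , refl =
    ≤-trans (s≤s (Unique⇒length≤ xs! xs⊆us++vs)) (≤-reflexive (sym (length-++-sucʳ us x vs)))
    where
    xs⊆us++vs : xs ⊆ₗ us ++ vs
    xs⊆us++vs z∈xs with ∈-++⁻ us (xs⊆ys (there z∈xs))
    ... | inj₁ z∈us         = ∈-++⁺ˡ z∈us
    ... | inj₂ (here refl)  = ⊥-elim (All.lookup x∉xs z∈xs refl)
    ... | inj₂ (there z∈vs) = ∈-++⁺ʳ us z∈vs

  Unique-++⁻ʳ : ∀ xs {ys : List A} → Unique (xs ++ ys) → Unique ys
  Unique-++⁻ʳ []       xs++ys!       = xs++ys!
  Unique-++⁻ʳ (x ∷ xs) (_ ∷ xs++ys!) = Unique-++⁻ʳ xs xs++ys!

  Unique-++⇒Disjoint : ∀ xs {ys : List A} → Unique (xs ++ ys) → Disjoint xs ys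
  Unique-++⇒Disjoint (x ∷ xs) (x∉ ∷ _)       (here refl , x∈ys) = All.lookup x∉ (∈-++⁺ʳ xs x∈ys) refl
  Unique-++⇒Disjoint (x ∷ xs) (_ ∷ xs++ys!)  (there v∈xs , v∈ys) = Unique-++⇒Disjoint xs xs++ys! (v∈xs , v∈ys)

  length-∷ʳ : ∀ (xs : List A) x → length (xs ∷ʳ x) ≡ suc (length xs)
  length-∷ʳ xs x = trans (length-++ xs) (+-comm (length xs) 1)

  length-∷ʳ≰ : ∀ (xs : List A) x → ¬ length (xs ∷ʳ x) ≤ length xs
  length-∷ʳ≰ xs x ≤xs = n≮n _ (subst (_≤ length xs) (length-∷ʳ xs x) ≤xs)

  ∈-∷ʳ⁻ : ∀ {xs : List A} {x y} → x ∈ₗ xs ∷ʳ y → x ∈ₗ xs ⊎ x ≡ y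
  ∈-∷ʳ⁻ {xs} x∈ with ∈-++⁻ xs x∈
  ... | inj₁ x∈xs         = inj₁ x∈xs
  ... | inj₂ (here x≡y)   = inj₂ x≡y

  ∈-∷ʳ⁺ : ∀ (xs : List A) {y} → y ∈ₗ xs ∷ʳ y
  ∈-∷ʳ⁺ xs = ∈-++⁺ʳ xs (here refl)

  ++-length-suc : ∀ (xs : List A) {ys} → length (xs ++ ys) ≡ suc (length xs) → ∃ λ y → ys ≡ [ y ]
  ++-length-suc []       {y ∷ []} _  = y , refl
  ++-length-suc (_ ∷ xs)          eq = ++-length-suc xs (suc-injective eq)

  length<length-∷ʳ : ∀ (xs ys : List A) x → length xs ≡ length ys → length ys < length (xs ∷ʳ x)
  length<length-∷ʳ xs _ x |xs|≡|ys| = ≤-reflexive (sym (trans (length-∷ʳ xs x) (cong suc |xs|≡|ys|)))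

  take-++-cases : ∀ j (xs ys : List A) →
                  (∃ λ zs → take j (xs ++ ys) ++ zs ≡ xs) ⊎
                  (∃ λ k → take j (xs ++ ys) ≡ xs ++ take (suc k) ys)
  take-++-cases zero    xs       ys = inj₁ (xs , refl)
  take-++-cases (suc j) []       ys = inj₂ (j , refl)
  take-++-cases (suc j) (x ∷ xs) ys with take-++-cases j xs ys
  ... | inj₁ (zs , eq) = inj₁ (zs , cong (x ∷_) eq)
  ... | inj₂ (k , eq)  = inj₂ (k , cong (x ∷_) eq)

≤-foldr-⊔ : ∀ {e m} xs → m ∈ₗ xs → m ≤ foldr _⊔_ e xs
≤-foldr-⊔ xs m∈xs =
  foldr-preservesᵒ (λ x y → [ m≤n⇒m≤n⊔o y , m≤n⇒m≤o⊔n x ]′) _ xs (inj₂ (Any.map ≤-reflexive m∈xs))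

foldr-⊓-≤ : ∀ {e m} xs → m ∈ₗ xs → foldr _⊓_ e xs ≤ m
foldr-⊓-≤ xs m∈xs =
  foldr-preservesᵒ (λ x y → [ m≤n⇒m⊓o≤n y , m≤n⇒o⊓m≤n x ]′) _ xs (inj₂ (Any.map (≤-reflexive ∘ sym) m∈xs))

module _ {n : ℕ} where

  ∈spanρ⁺ : ∀ (h : Subset n → ℕ) {X y} → h (X ∪ ⁅ y ⁆) ≡ h X → y ∈ spanρ h X
  ∈spanρ⁺ h {y = y} eq =
    lookup⇒[]= y _ (trans (lookup∘tabulate _ y) (Equivalence.to T-≡ (≡⇒≡ᵇ _ _ eq)))

  ∈spanρ⁻ : ∀ (h : Subset n → ℕ) {X y} → y ∈ spanρ h X → h (X ∪ ⁅ y ⁆) ≡ h X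
  ∈spanρ⁻ h {y = y} y∈ =
    ≡ᵇ⇒≡ _ _ (Equivalence.from T-≡ (trans (sym (lookup∘tabulate _ y)) ([]=⇒lookup y∈)))

  x∈⋃⁺ : ∀ (L : List (Subset n)) {x s} → s ∈ₗ L → x ∈ s → x ∈ ⋃ L
  x∈⋃⁺ (t ∷ L) (here refl) x∈s = x∈p∪q⁺ (inj₁ x∈s)
  x∈⋃⁺ (t ∷ L) (there s∈L) x∈s = x∈p∪q⁺ (inj₂ (x∈⋃⁺ L s∈L x∈s))

  x∈⋃⁻ : ∀ (L : List (Subset n)) {x} → x ∈ ⋃ L → ∃ λ s → s ∈ₗ L × x ∈ s
  x∈⋃⁻ []      x∈⋃ = ⊥-elim (∉⊥ x∈⋃)
  x∈⋃⁻ (t ∷ L) x∈⋃ with x∈p∪q⁻ t (⋃ L) x∈⋃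
  ... | inj₁ x∈t = t , here refl , x∈t
  ... | inj₂ x∈⋃L with x∈⋃⁻ L x∈⋃L
  ...   | s , s∈L , x∈s = s , there s∈L , x∈s

  ∪-lub : ∀ {X Y Z : Subset n} → X ⊆ Z → Y ⊆ Z → X ∪ Y ⊆ Z
  ∪-lub {X} {Y} X⊆Z Y⊆Z x∈ = [ X⊆Z , Y⊆Z ]′ (x∈p∪q⁻ X Y x∈)

  ∩-mono : ∀ {X X′ Y Y′ : Subset n} → X ⊆ X′ → Y ⊆ Y′ → X ∩ Y ⊆ X′ ∩ Y′
  ∩-mono {X} {Y = Y} X⊆X′ Y⊆Y′ x∈ = let x∈X , x∈Y = x∈p∩q⁻ X Y x∈ in x∈p∩q⁺ (X⊆X′ x∈X , Y⊆Y′ x∈Y)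

  ⁅⁆-⊆ : ∀ {Y : Subset n} {y} → y ∈ Y → ⁅ y ⁆ ⊆ Y
  ⁅⁆-⊆ {y = y} y∈Y x∈⁅y⁆ = subst (_∈ _) (sym (x∈⁅y⁆⇒x≡y y x∈⁅y⁆)) y∈Y

  X⊆spanρ : ∀ (h : Subset n → ℕ) X → X ⊆ spanρ h X
  X⊆spanρ h X {y} y∈X = ∈spanρ⁺ h (cong h (⊆-antisym (∪-lub ⊆-refl (⁅⁆-⊆ y∈X)) (p⊆p∪q ⁅ y ⁆)))

  ⊈⇒∃∉ : ∀ {p q : Subset n} → ¬ p ⊆ q → ∃ λ x → x ∈ p × x ∉ q
  ⊈⇒∃∉ {p} {q} p⊈q with ¬∀⟶∃¬ n (λ x → x ∈ p → x ∈ q) (λ x → x ∈? p →-dec x ∈? q) (λ p⊆q → p⊈q (p⊆q _))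
  ... | x , x∈p↛x∈q = x , decidable-stable (x ∈? p) (λ x∉p → x∈p↛x∈q (⊥-elim ∘ x∉p)) , x∈p↛x∈q ∘ λ x∈q _ → x∈q

  ∈-letters⁺ : ∀ {x : Fin n} {w} → x ∈ₗ w → x ∈ letters w
  ∈-letters⁺ {w = y ∷ w} (here refl)  = x∈p∪q⁺ (inj₁ (x∈⁅x⁆ y))
  ∈-letters⁺ {w = y ∷ w} (there x∈w) = x∈p∪q⁺ (inj₂ (∈-letters⁺ x∈w))

  ∈-letters⁻ : ∀ {x : Fin n} w → x ∈ letters w → x ∈ₗ w
  ∈-letters⁻ []      x∈ = ⊥-elim (∉⊥ x∈)
  ∈-letters⁻ (y ∷ w) x∈ with x∈p∪q⁻ ⁅ y ⁆ (letters w) x∈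
  ... | inj₁ x∈⁅y⁆ = here (x∈⁅y⁆⇒x≡y y x∈⁅y⁆)
  ... | inj₂ x∈w   = there (∈-letters⁻ w x∈w)

  letters-⊆ : ∀ (w : Word n) {X} → (∀ {x} → x ∈ₗ w → x ∈ X) → letters w ⊆ X
  letters-⊆ w w⊆X x∈ = w⊆X (∈-letters⁻ w x∈)

  letters-∷ʳ-⊆ : ∀ (w : Word n) {X y} → letters w ⊆ X → y ∈ X → letters (w ∷ʳ y) ⊆ X
  letters-∷ʳ-⊆ w w⊆X y∈X = letters-⊆ (w ∷ʳ _) λ x∈ → [ w⊆X ∘ ∈-letters⁺ , (λ { refl → y∈X }) ]′ (∈-∷ʳ⁻ x∈)

  ∈-wordsUpTo : ∀ k {w : Word n} → length w ≤ k → w ∈ₗ wordsUpTo k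
  ∈-wordsUpTo zero    {[]}    _       = here refl
  ∈-wordsUpTo (suc k) {[]}    _       = here refl
  ∈-wordsUpTo (suc k) {x ∷ w} (s≤s ≤k) =
    there (∈-concatMap⁺ _ (Any.map (λ { refl → ∈-map⁺ (x ∷_) (∈-wordsUpTo k ≤k) }) (∈-allFin x)))

T-⇔⇒≡ : ∀ {a b} → (T a → T b) → (T b → T a) → a ≡ b
T-⇔⇒≡ {false} {false} _ _ = refl
T-⇔⇒≡ {false} {true}  _ g = ⊥-elim (g _)
T-⇔⇒≡ {true}  {false} f _ = ⊥-elim (f _)
T-⇔⇒≡ {true}  {true}  _ _ = refl

module Notation {n : ℕ} (Λ : Language n) where

  infix 4 _∈Γ_ _∼_ _⊏_ _⊑_ _≺_

  Feasible : Word n → Set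
  Feasible = Defs.Feasible Λ

  _∈Γ_ : Fin n → Word n → Set
  _∈Γ_ = Defs._∈Γ_ Λ

  _∼_ _⊏_ _⊑_ _≺_ : Word n → Word n → Set
  _∼_ = Defs._∼_ Λ
  _⊏_ = Defs._⊏_ Λ
  _⊑_ = Defs._⊑_ Λ
  _≺_ = Defs._≺_ Λ

  IsMeet : Word n → Word n → Word n → Set
  IsMeet = Defs.IsMeet Λ

  IsBasic : Word n → Set
  IsBasic = Defs.IsBasic Λ

  feasibleWords : List (Word n)
  feasibleWords = Defs.feasibleWords Λ

  rank ρ♮ : Subset n → ℕ
  rank = Defs.rank Λ
  ρ♮   = Defs.ρ♮ Λ

  spanR kernel : Subset n → Subset n
  spanR  = Defs.spanR Λ
  kernel = Defs.kernel Λ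

  κw : Word n → Subset n
  κw = Defs.κw Λ

module Greedoid {n : ℕ} {Λ : Language n} (G : IsGreedoid Λ) where

  open IsGreedoid G
  open Notation Λ public

  Feasible-[] : Feasible []
  Feasible-[] = hereditary [] _ (proj₂ nonempty)

  Feasible-take : ∀ i {w} → Feasible w → Feasible (take i w)
  Feasible-take i {w} fw = hereditary (take i w) (drop i w) (subst Feasible (sym (take++drop≡id i w)) fw)

  Feasible⇒length≤n : ∀ {w} → Feasible w → length w ≤ n
  Feasible⇒length≤n {w} fw =
    subst (length w ≤_) (length-tabulate (λ x → x)) (Unique⇒length≤ (simple w fw) (λ {x} _ → ∈-allFin x))

  ∈⇒∉Γ : ∀ {α y} → Feasible α → y ∈ₗ α → ¬ y ∈Γ α
  ∈⇒∉Γ {α} _ y∈α fαy = Unique-++⇒Disjoint α (simple _ fαy) (y∈α , here refl)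

  ∈-feasibleWords : ∀ {w} → Feasible w → w ∈ₗ feasibleWords
  ∈-feasibleWords fw = ∈-filter⁺ (T? ∘ Λ) (∈-wordsUpTo n (Feasible⇒length≤n fw)) fw

  ∈-feasibleWords⁻ : ∀ {w} → w ∈ₗ feasibleWords → Feasible w
  ∈-feasibleWords⁻ w∈ = proj₂ (∈-filter⁻ (T? ∘ Λ) {xs = wordsUpTo n} w∈)

  length≤rank : ∀ {X β} → Feasible β → letters β ⊆ X → length β ≤ rank X
  length≤rank {X} fβ β⊆X = ≤-foldr-⊔ _ (∈-map⁺ length
    (∈-filter⁺ (T? ∘ λ β → letters β ⊆ᵇ X) (∈-feasibleWords fβ) (fromWitness (λ {x} → β⊆X {x}))))

  IsBasis : Subset n → Word n → Set
  IsBasis X γ = Feasible γ × letters γ ⊆ X × length γ ≡ rank X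

  basis : ∀ X → ∃ (IsBasis X)
  basis X with foldr-selective ⊔-sel 0 (map length (filterᵇ (λ β → letters β ⊆ᵇ X) feasibleWords))
  ... | inj₁ rank≡0 = [] , Feasible-[] , ⊥-elim ∘ ∉⊥ , sym rank≡0
  ... | inj₂ rank∈  with ∈-map⁻ length rank∈
  ...   | γ , γ∈ , rank≡ with ∈-filter⁻ (T? ∘ λ β → letters β ⊆ᵇ X) {xs = feasibleWords} γ∈
  ...     | γ∈feasible , γ⊆X = γ , ∈-feasibleWords⁻ γ∈feasible , toWitness γ⊆X , sym rank≡

  basis-maximal : ∀ {X γ β} → IsBasis X γ → Feasible β → letters β ⊆ X → length β ≤ length γ
  basis-maximal (_ , _ , |γ|≡) fβ β⊆X = ≤-trans (length≤rank fβ β⊆X) (≤-reflexive (sym |γ|≡))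

  basis-spans : ∀ {X γ z} → IsBasis X γ → z ∈ X → ¬ z ∈Γ γ
  basis-spans {γ = γ} {z} Bγ@(_ , γ⊆X , _) z∈X fγz =
    length-∷ʳ≰ γ z (basis-maximal Bγ fγz (letters-∷ʳ-⊆ γ γ⊆X z∈X))

  augment : ∀ {u w} → Feasible u → Feasible w → length u ≤ length w →
            ∃ λ c → Feasible (u ++ c) × length (u ++ c) ≡ length w × c ⊆ₗ w
  augment {u} {w} fu fw u≤w = go (length w ∸ length u) fu (m+[n∸m]≡n u≤w)
    where
    go : ∀ k {u} → Feasible u → length u + k ≡ length w →
         ∃ λ c → Feasible (u ++ c) × length (u ++ c) ≡ length w × c ⊆ₗ w
    go zero {u} fu |u|≡ =
      [] , subst Feasible (sym (++-identityʳ u)) fu ,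
      trans (cong length (++-identityʳ u)) (trans (sym (+-identityʳ _)) |u|≡) , λ ()
    go (suc k) {u} fu |u|+k≡ with exchange w u fw fu (subst (length u <_) |u|+k≡ (m<m+n (length u) (s≤s z≤n)))
    ... | x , x∈w , fux with go k fux (trans (cong (_+ k) (length-∷ʳ u x)) (trans (sym (+-suc _ k)) |u|+k≡))
    ...   | c , fuxc , |uxc|≡ , c⊆w =
      x ∷ c , subst Feasible (∷ʳ-++ u x c) fuxc , trans (cong length (sym (∷ʳ-++ u x c))) |uxc|≡ ,
      λ { (here refl) → x∈w ; (there y∈c) → c⊆w y∈c }

  extendToBasis : ∀ {X u} → Feasible u → letters u ⊆ X → ∃ λ c → IsBasis X (u ++ c)
  extendToBasis {X} {u} fu u⊆X with basis X
  ... | γ , Bγ@(fγ , γ⊆X , |γ|≡) with augment fu fγ (basis-maximal Bγ fu u⊆X)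
  ...   | c , fuc , |uc|≡ , c⊆γ = c , fuc , uc⊆X , trans |uc|≡ |γ|≡
    where
    uc⊆X : letters (u ++ c) ⊆ X
    uc⊆X = letters-⊆ (u ++ c) λ x∈ → [ u⊆X ∘ ∈-letters⁺ , γ⊆X ∘ ∈-letters⁺ ∘ c⊆γ ]′ (∈-++⁻ u x∈)

  -- For feasible α, Spans α μ says μ̃ ⊆ σ_r(α̃) (see ∈spanR⁺ and ∈spanR⁻).
  Spans : Word n → Word n → Set
  Spans α μ = ∀ {z} → z ∈ₗ μ → ¬ z ∈Γ α

  Spans⇒length≤ : ∀ {α μ} → Feasible α → Feasible μ → Spans α μ → length μ ≤ length α
  Spans⇒length≤ {α} {μ} fα fμ α⊒μ = ≮⇒≥ λ |α|<|μ| →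
    let x , x∈μ , fαx = exchange μ α fμ fα |α|<|μ| in α⊒μ x∈μ fαx

  Spans⇒∼ : ∀ {α β} → Feasible α → Feasible β → Spans β α → length α ≡ length β → α ∼ β
  Spans⇒∼ {α} {β} fα fβ β⊒α |α|≡|β| x = T-⇔⇒≡ αx⇒βx βx⇒αx
    where
    αx⇒βx : x ∈Γ α → x ∈Γ β
    αx⇒βx fαx with exchange (α ∷ʳ x) β fαx fβ (length<length-∷ʳ α β x |α|≡|β|)
    ... | z , z∈αx , fβz with ∈-∷ʳ⁻ z∈αx
    ...   | inj₁ z∈α = ⊥-elim (β⊒α z∈α fβz)
    ...   | inj₂ refl = fβz
    -- a letter z of β with αz feasible would give a word αz spanned by β and longer than β
    βx⇒αx : x ∈Γ β → x ∈Γ α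
    βx⇒αx fβx with exchange (β ∷ʳ x) α fβx fα (length<length-∷ʳ β α x (sym |α|≡|β|))
    ... | z , z∈βx , fαz with ∈-∷ʳ⁻ z∈βx
    ...   | inj₂ refl = fαz
    ...   | inj₁ z∈β  =
      ⊥-elim (length-∷ʳ≰ α z (≤-trans (Spans⇒length≤ fβ fαz β⊒αz) (≤-reflexive (sym |α|≡|β|))))
      where
      β⊒αz : Spans β (α ∷ʳ z)
      β⊒αz y∈ = [ β⊒α , (λ { refl → ∈⇒∉Γ fβ z∈β }) ]′ (∈-∷ʳ⁻ y∈)

  ∼-refl : ∀ {α} → α ∼ α
  ∼-refl _ = refl

  ∼-sym : ∀ {α β} → α ∼ β → β ∼ α
  ∼-sym α∼β x = sym (α∼β x)

  ∼⇒length≮ : ∀ {α β} → Feasible α → Feasible β → α ∼ β → ¬ length α < length β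
  ∼⇒length≮ {α} {β} fα fβ α∼β |α|<|β| =
    let x , x∈β , fαx = exchange β α fβ fα |α|<|β| in ∈⇒∉Γ fβ x∈β (subst T (α∼β x) fαx)

  ∼⇒length≡ : ∀ {α β} → Feasible α → Feasible β → α ∼ β → length α ≡ length β
  ∼⇒length≡ fα fβ α∼β = ≤-antisym (≮⇒≥ (∼⇒length≮ fβ fα (∼-sym α∼β))) (≮⇒≥ (∼⇒length≮ fα fβ α∼β))

  ++∼⇒⊑ : ∀ {α β} c → Feasible (α ++ c) → α ++ c ∼ β → α ⊑ β
  ++∼⇒⊑ {α} {β} []      _   αc∼β = inj₁ (subst (_∼ β) (++-identityʳ α) αc∼β)
  ++∼⇒⊑         (y ∷ c) fαc αc∼β = inj₂ (y ∷ c , (λ ()) , fαc , αc∼β)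

  ⊑⇒++∼ : ∀ {α β} → Feasible α → α ⊑ β → ∃ λ c → Feasible (α ++ c) × α ++ c ∼ β
  ⊑⇒++∼ {α} fα (inj₁ α∼β) =
    [] , subst Feasible (sym (++-identityʳ α)) fα , subst (_∼ _) (sym (++-identityʳ α)) α∼β
  ⊑⇒++∼ _ (inj₂ (c , _ , fαc , αc∼β)) = c , fαc , αc∼β

  ⊑-++ : ∀ {α} c → Feasible (α ++ c) → α ⊑ α ++ c
  ⊑-++ c fαc = ++∼⇒⊑ c fαc ∼-refl

  ⊑⇒length≤ : ∀ {α β} → Feasible α → Feasible β → α ⊑ β → length α ≤ length β
  ⊑⇒length≤ {α} fα fβ α⊑β with ⊑⇒++∼ fα α⊑β
  ... | c , fαc , αc∼β = ≤-trans (length-++-≤ˡ α) (≤-reflexive (∼⇒length≡ fαc fβ αc∼β))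

  ⊏⇒length< : ∀ {α β} → Feasible β → α ⊏ β → length α < length β
  ⊏⇒length< _ ([] , c≢[] , _) = ⊥-elim (c≢[] refl)
  ⊏⇒length< {α} fβ (y ∷ c , _ , fαc , αc∼β) =
    <-≤-trans (s≤s (length-++-≤ˡ α))
              (≤-reflexive (trans (sym (length-++-sucʳ α y c)) (∼⇒length≡ fαc fβ αc∼β)))

  ⊑∧length≥⇒∼ : ∀ {α β} → Feasible α → Feasible β → α ⊑ β → length β ≤ length α → α ∼ β
  ⊑∧length≥⇒∼ _  _  (inj₁ α∼β) _         = α∼β
  ⊑∧length≥⇒∼ _  fβ (inj₂ α⊏β) |β|≤|α| = ⊥-elim (n≮n _ (<-≤-trans (⊏⇒length< fβ α⊏β) |β|≤|α|))

  Spans⇒⊑ : ∀ {α β} → Feasible α → Feasible β → Spans β α → α ⊑ β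
  Spans⇒⊑ {α} {β} fα fβ β⊒α with augment fα fβ (Spans⇒length≤ fβ fα β⊒α)
  ... | c , fαc , |αc|≡ , c⊆β = ++∼⇒⊑ c fαc (Spans⇒∼ fαc fβ β⊒αc |αc|≡)
    where
    β⊒αc : Spans β (α ++ c)
    β⊒αc z∈ = [ β⊒α , ∈⇒∉Γ fβ ∘ c⊆β ]′ (∈-++⁻ α z∈)

  letters-basis : ∀ {α} → Feasible α → IsBasis (letters α) α
  letters-basis {α} fα = fα , ⊆-refl , ≤-antisym (length≤rank fα ⊆-refl) rank≤|α|
    where
    rank≤|α| : rank (letters α) ≤ length α
    rank≤|α| with basis (letters α)
    ... | γ , fγ , γ⊆α , |γ|≡ =
      subst (_≤ length α) |γ|≡ (Unique⇒length≤ (simple γ fγ) (∈-letters⁻ α ∘ γ⊆α ∘ ∈-letters⁺))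

  rank-∪⁅⁆≥ : ∀ {X} y → rank X ≤ rank (X ∪ ⁅ y ⁆)
  rank-∪⁅⁆≥ {X} y with basis X
  ... | γ , fγ , γ⊆X , |γ|≡ = subst (_≤ rank (X ∪ ⁅ y ⁆)) |γ|≡ (length≤rank fγ (p⊆p∪q ⁅ y ⁆ ∘ γ⊆X))

  ∈spanR⁺ : ∀ {X γ y} → IsBasis X γ → ¬ y ∈Γ γ → y ∈ spanR X
  ∈spanR⁺ {X} {γ} {y} Bγ@(_ , _ , |γ|≡) y∉Γγ = ∈spanρ⁺ rank (≤-antisym rank≤ (rank-∪⁅⁆≥ y))
    where
    no-longer : ∀ {β} → Feasible β → letters β ⊆ X ∪ ⁅ y ⁆ → ¬ length γ < length β
    no-longer {β} fβ β⊆ |γ|<|β| with exchange β γ fβ (proj₁ Bγ) |γ|<|β|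
    ... | x , x∈β , fγx with x∈p∪q⁻ X ⁅ y ⁆ (β⊆ (∈-letters⁺ x∈β))
    ...   | inj₁ x∈X   = basis-spans Bγ x∈X fγx
    ...   | inj₂ x∈⁅y⁆ = y∉Γγ (subst (_∈Γ γ) (x∈⁅y⁆⇒x≡y y x∈⁅y⁆) fγx)
    rank≤ : rank (X ∪ ⁅ y ⁆) ≤ rank X
    rank≤ with basis (X ∪ ⁅ y ⁆)
    ... | β , fβ , β⊆ , |β|≡ = subst₂ _≤_ |β|≡ |γ|≡ (≮⇒≥ (no-longer fβ β⊆))

  ∈spanR⁻ : ∀ {X γ y} → IsBasis X γ → y ∈ spanR X → ¬ y ∈Γ γ
  ∈spanR⁻ {X} {γ} {y} (_ , γ⊆X , |γ|≡) y∈ fγy = length-∷ʳ≰ γ y (begin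
    length (γ ∷ʳ y)     ≤⟨ length≤rank fγy (letters-∷ʳ-⊆ γ (p⊆p∪q ⁅ y ⁆ ∘ γ⊆X) (q⊆p∪q X ⁅ y ⁆ (x∈⁅x⁆ y))) ⟩
    rank (X ∪ ⁅ y ⁆)    ≡⟨ ∈spanρ⁻ rank y∈ ⟩
    rank X              ≡⟨ sym |γ|≡ ⟩
    length γ            ∎)
    where
    open ≤-Reasoning

  -- kernel X is definitionally ⋃feasibleIn (spanR X).
  ⋃feasibleIn : Subset n → Subset n
  ⋃feasibleIn S = ⋃ (map letters (filterᵇ (λ β → letters β ⊆ᵇ S) feasibleWords))

  ∈kernel⁺ : ∀ {X μ y} → Feasible μ → letters μ ⊆ spanR X → y ∈ₗ μ → y ∈ kernel X
  ∈kernel⁺ {X} {μ} fμ μ⊆ y∈μ = x∈⋃⁺ _ (∈-map⁺ letters μ∈) (∈-letters⁺ y∈μ)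
    where
    μ∈ : μ ∈ₗ filterᵇ (λ β → letters β ⊆ᵇ spanR X) feasibleWords
    μ∈ = ∈-filter⁺ (T? ∘ λ β → letters β ⊆ᵇ spanR X) (∈-feasibleWords fμ) (fromWitness (λ {x} → μ⊆ {x}))

  ∈kernel⁻ : ∀ {X y} → y ∈ kernel X → ∃ λ μ → Feasible μ × letters μ ⊆ spanR X × y ∈ₗ μ
  ∈kernel⁻ {X} y∈ with x∈⋃⁻ _ y∈
  ... | _ , s∈ , y∈s with ∈-map⁻ letters s∈
  ...   | μ , μ∈ , refl with ∈-filter⁻ (T? ∘ λ β → letters β ⊆ᵇ spanR X) {xs = feasibleWords} μ∈
  ...     | μ∈feasible , μ⊆ = μ , ∈-feasibleWords⁻ μ∈feasible , toWitness μ⊆ , ∈-letters⁻ μ y∈s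

  kernel⊆spanR : ∀ {X} → kernel X ⊆ spanR X
  kernel⊆spanR y∈ with ∈kernel⁻ y∈
  ... | _ , _ , μ⊆ , y∈μ = μ⊆ (∈-letters⁺ y∈μ)

  kernel-basis : ∀ {X γ} → IsBasis X γ → kernel X ≡ κw γ
  kernel-basis Bγ@(fγ , _) = cong ⋃feasibleIn (⊆-antisym
    (λ y∈ → ∈spanR⁺ (letters-basis fγ) (∈spanR⁻ Bγ y∈))
    (λ y∈ → ∈spanR⁺ Bγ (∈spanR⁻ (letters-basis fγ) y∈)))

  ∈κ⁺ : ∀ {α μ y} → Feasible α → Feasible μ → Spans α μ → y ∈ₗ μ → y ∈ κw α
  ∈κ⁺ {μ = μ} fα fμ α⊒μ = ∈kernel⁺ fμ (letters-⊆ μ (∈spanR⁺ (letters-basis fα) ∘ α⊒μ))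

  κ-spans : ∀ {α y} → Feasible α → y ∈ κw α → ¬ y ∈Γ α
  κ-spans fα = ∈spanR⁻ (letters-basis fα) ∘ kernel⊆spanR

  letters⊆κ : ∀ {α} → Feasible α → letters α ⊆ κw α
  letters⊆κ {α} fα y∈ = ∈κ⁺ fα fα (∈⇒∉Γ fα) (∈-letters⁻ α y∈)

  ∼⇒κ≡ : ∀ {α β} → Feasible α → Feasible β → α ∼ β → κw α ≡ κw β
  ∼⇒κ≡ fα fβ α∼β = cong ⋃feasibleIn (⊆-antisym (transfer fα fβ α∼β) (transfer fβ fα (∼-sym α∼β)))
    where
    transfer : ∀ {α β} → Feasible α → Feasible β → α ∼ β → spanR (letters α) ⊆ spanR (letters β)
    transfer fα fβ α∼β {y} y∈ =
      ∈spanR⁺ (letters-basis fβ) (∈spanR⁻ (letters-basis fα) y∈ ∘ subst T (sym (α∼β y)))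

  ⊆κ⇒⊑ : ∀ {δ α} → Feasible δ → Feasible α → letters δ ⊆ κw α → δ ⊑ α
  ⊆κ⇒⊑ fδ fα δ⊆κα = Spans⇒⊑ fδ fα (κ-spans fα ∘ δ⊆κα ∘ ∈-letters⁺)

  κ⊆⇒⊑ : ∀ {α β} → Feasible α → Feasible β → κw α ⊆ κw β → α ⊑ β
  κ⊆⇒⊑ fα fβ κα⊆κβ = ⊆κ⇒⊑ fα fβ (κα⊆κβ ∘ letters⊆κ fα)

  kernel-κ : ∀ {δ} → Feasible δ → kernel (κw δ) ≡ κw δ
  kernel-κ {δ} fδ =
    let γ , Bγ        = basis (κw δ)
        fγ , γ⊆κδ , _ = Bγ
        γ∼δ           = ⊑∧length≥⇒∼ fγ fδ (⊆κ⇒⊑ fγ fδ γ⊆κδ) (basis-maximal Bγ fδ (letters⊆κ fδ))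
    in trans (kernel-basis {κw δ} {γ} Bγ) (∼⇒κ≡ fγ fδ γ∼δ)

  extendToBasic : ∀ {u} → Feasible u → ∃ λ c → IsBasic (u ++ c)
  extendToBasic fu with extendToBasis fu (λ _ → ∈⊤)
  ... | c , Buc@(fuc , _) = c , fuc , λ w fw → basis-maximal Buc fw (λ _ → ∈⊤)

  basic-spans : ∀ {b μ} → IsBasic b → Spans b μ
  basic-spans {b} (_ , maximal) {z} _ fbz = length-∷ʳ≰ b z (maximal (b ∷ʳ z) fbz)

  ∈Γ-prefix : ∀ {p u zs y} → Feasible p → y ∉ κw p → u ++ zs ≡ p → y ∈Γ u → y ∈Γ p
  ∈Γ-prefix {p} {u} {y = y} fp y∉κp u++zs≡p fuy = decidable-stable (T? (Λ (p ∷ʳ y))) λ y∉Γp →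
    y∉κp (∈κ⁺ {p} {u ∷ʳ y} fp fuy (p⊒uy y∉Γp) (∈-∷ʳ⁺ u))
    where
    p⊒uy : ¬ y ∈Γ p → Spans p (u ∷ʳ y)
    p⊒uy y∉Γp z∈ =
      [ (λ z∈u → ∈⇒∉Γ fp (subst (_ ∈ₗ_) u++zs≡p (∈-++⁺ˡ z∈u))) , (λ { refl → y∉Γp }) ]′ (∈-∷ʳ⁻ z∈)

module KernelMeet {n : ℕ} {Λ : Language n} (G : IsGreedoid Λ) (kernelMeet : KernelMeetProperty Λ) where

  open IsGreedoid G
  open Greedoid G

  -- If α ⊑ β then α is the meet of α and β, so κ[α] = κ[α] ∩ κ[β].
  ⊑⇒κ⊆ : ∀ {α β} → Feasible α → Feasible β → α ⊑ β → κw α ⊆ κw β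
  ⊑⇒κ⊆ {α} {β} fα fβ α⊑β {x} x∈κα =
    proj₂ (x∈p∩q⁻ (κw α) (κw β) (subst (x ∈_) (kernelMeet α β α fα fβ fα α-meet) x∈κα))
    where
    α-meet : IsMeet α α β
    α-meet = inj₁ (∼-refl {α}) , α⊑β , λ _ _ δ⊑α _ → δ⊑α

  κ⊂⇒⊏ : ∀ {α β} → Feasible α → Feasible β → κw α ⊂ κw β → α ⊏ β
  κ⊂⇒⊏ fα fβ (κα⊆κβ , x , x∈κβ , x∉κα) =
    [ (λ α∼β → ⊥-elim (x∉κα (subst (x ∈_) (sym (∼⇒κ≡ fα fβ α∼β)) x∈κβ))) , (λ α⊏β → α⊏β) ]′ (κ⊆⇒⊑ fα fβ κα⊆κβ)

  ⊏⇒κ⊂ : ∀ {α β} → Feasible α → Feasible β → α ⊏ β → κw α ⊂ κw β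
  ⊏⇒κ⊂ fα fβ α⊏β = ⊑⇒κ⊆ fα fβ (inj₂ α⊏β) , ⊈⇒∃∉ λ κβ⊆κα →
    n≮n _ (<-≤-trans (⊏⇒length< fβ α⊏β) (⊑⇒length≤ fβ fα (κ⊆⇒⊑ fβ fα κβ⊆κα)))

  basis-isMeet : ∀ {α β γ} → Feasible α → Feasible β → IsBasis (κw α ∩ κw β) γ → IsMeet γ α β
  basis-isMeet {α} {β} {γ} fα fβ Bγ@(fγ , γ⊆ , _) =
    ⊆κ⇒⊑ fγ fα (p∩q⊆p (κw α) (κw β) ∘ γ⊆) , ⊆κ⇒⊑ fγ fβ (p∩q⊆q (κw α) (κw β) ∘ γ⊆) , below
    where
    below : ∀ δ → Feasible δ → δ ⊑ α → δ ⊑ β → δ ⊑ γ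
    below δ fδ δ⊑α δ⊑β = Spans⇒⊑ fδ fγ (basis-spans Bγ ∘ κδ⊆κα∩κβ ∘ letters⊆κ fδ ∘ ∈-letters⁺)
      where
      κδ⊆κα∩κβ : κw δ ⊆ κw α ∩ κw β
      κδ⊆κα∩κβ x∈ = x∈p∩q⁺ (⊑⇒κ⊆ fδ fα δ⊑α x∈ , ⊑⇒κ⊆ fδ fβ δ⊑β x∈)

  join-basis : ∀ {α β γ} a b c → Feasible α → Feasible β → Feasible (γ ++ a) → γ ++ a ∼ α →
               Feasible (γ ++ b) → γ ++ b ∼ β → IsBasis (letters (γ ++ a) ∪ letters b) ((γ ++ a) ++ c) →
               κw α ⊆ κw ((γ ++ a) ++ c) × κw β ⊆ κw ((γ ++ a) ++ c) ×
               length ((γ ++ a) ++ c) + length γ ≤ length α + length β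
  join-basis {α} {β} {γ} a b c fα fβ fγa γa∼α fγb γb∼β Bδ@(fδ , δ⊆ , _) =
    κα⊆κδ , κβ⊆κδ , length-bound
    where
    U : Subset n
    U = letters (γ ++ a) ∪ letters b
    κα⊆κδ : κw α ⊆ κw ((γ ++ a) ++ c)
    κα⊆κδ {x} x∈κα = ⊑⇒κ⊆ fγa fδ (⊑-++ c fδ) (subst (x ∈_) (∼⇒κ≡ fα fγa (∼-sym γa∼α)) x∈κα)
    γb⊆U : ∀ {z} → z ∈ₗ γ ++ b → z ∈ U
    γb⊆U z∈ = [ p⊆p∪q (letters b) ∘ ∈-letters⁺ ∘ ∈-++⁺ˡ , q⊆p∪q (letters (γ ++ a)) (letters b) ∘ ∈-letters⁺ ]′
                (∈-++⁻ γ z∈)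
    κβ⊆κδ : κw β ⊆ κw ((γ ++ a) ++ c)
    κβ⊆κδ {x} x∈κβ =
      ⊑⇒κ⊆ fγb fδ (Spans⇒⊑ fγb fδ (basis-spans Bδ ∘ γb⊆U)) (subst (x ∈_) (∼⇒κ≡ fβ fγb (∼-sym γb∼β)) x∈κβ)
    c⊆b : c ⊆ₗ b
    c⊆b {z} z∈c with x∈p∪q⁻ (letters (γ ++ a)) (letters b) (δ⊆ (∈-letters⁺ (∈-++⁺ʳ (γ ++ a) z∈c)))
    ... | inj₁ z∈γa = ⊥-elim (Unique-++⇒Disjoint (γ ++ a) (simple _ fδ) (∈-letters⁻ (γ ++ a) z∈γa , z∈c))
    ... | inj₂ z∈b  = ∈-letters⁻ b z∈b
    |c|≤|b| : length c ≤ length b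
    |c|≤|b| = Unique⇒length≤ (Unique-++⁻ʳ (γ ++ a) (simple _ fδ)) c⊆b
    open ≤-Reasoning
    length-bound : length ((γ ++ a) ++ c) + length γ ≤ length α + length β
    length-bound = begin
      length ((γ ++ a) ++ c) + length γ       ≡⟨ cong (_+ length γ) (length-++ (γ ++ a)) ⟩
      length (γ ++ a) + length c + length γ   ≡⟨ +-assoc (length (γ ++ a)) (length c) (length γ) ⟩
      length (γ ++ a) + (length c + length γ) ≡⟨ cong (length (γ ++ a) +_) (+-comm (length c) (length γ)) ⟩
      length (γ ++ a) + (length γ + length c) ≤⟨ +-monoʳ-≤ (length (γ ++ a)) (+-monoʳ-≤ (length γ) |c|≤|b|) ⟩
      length (γ ++ a) + (length γ + length b) ≡⟨ cong (length (γ ++ a) +_) (sym (length-++ γ)) ⟩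
      length (γ ++ a) + length (γ ++ b)       ≡⟨ cong₂ _+_ (∼⇒length≡ fγa fα γa∼α) (∼⇒length≡ fγb fβ γb∼β) ⟩
      length α + length β                     ∎

  join : ∀ {α β γ} → Feasible α → Feasible β → Feasible γ → γ ⊑ α → γ ⊑ β →
         ∃ λ δ → Feasible δ × κw α ⊆ κw δ × κw β ⊆ κw δ × length δ + length γ ≤ length α + length β
  join {γ = γ} fα fβ fγ γ⊑α γ⊑β =
    let a , fγa , γa∼α = ⊑⇒++∼ fγ γ⊑α
        b , fγb , γb∼β = ⊑⇒++∼ fγ γ⊑β
        c , Bδ         = extendToBasis {X = letters (γ ++ a) ∪ letters b} {γ ++ a} fγa (p⊆p∪q (letters b))
    in (γ ++ a) ++ c , proj₁ Bδ , join-basis a b c fα fβ fγa γa∼α fγb γb∼β Bδ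

module RhoNatural {n : ℕ} {Λ : Language n} (G : IsGreedoid Λ) (normal : IsNormal Λ)
                  (kernelMeet : KernelMeetProperty Λ) where

  open Greedoid G
  open KernelMeet G kernelMeet

  ρ♮≤length : ∀ {X α} → Feasible α → X ⊆ κw α → ρ♮ X ≤ length α
  ρ♮≤length {X} fα X⊆κα = foldr-⊓-≤ _ (∈-map⁺ length
    (∈-filter⁺ (T? ∘ λ α → X ⊆ᵇ κw α) (∈-feasibleWords fα) (fromWitness (λ {x} → X⊆κα {x}))))

  ⊆κ-basic : ∀ {X b} → IsBasic b → X ⊆ κw b
  ⊆κ-basic b-basic@(fb , _) {x} _ = let w , fw , x∈w = normal x in ∈κ⁺ fb fw (basic-spans b-basic) x∈w

  ρ♮-attained : ∀ X → ∃ λ α → Feasible α × X ⊆ κw α × length α ≡ ρ♮ X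
  ρ♮-attained X = [ attained-by-basic , attained-in-list ]′ (foldr-selective ⊓-sel n (map length candidates))
    where
    candidates : List (Word n)
    candidates = filterᵇ (λ α → X ⊆ᵇ κw α) feasibleWords
    attained-in-list : ρ♮ X ∈ₗ map length candidates → ∃ λ α → Feasible α × X ⊆ κw α × length α ≡ ρ♮ X
    attained-in-list ρ♮∈ =
      let α , α∈ , ρ♮≡      = ∈-map⁻ length ρ♮∈
          α∈feasible , X⊆κα = ∈-filter⁻ (T? ∘ λ α → X ⊆ᵇ κw α) {xs = feasibleWords} α∈
      in α , ∈-feasibleWords⁻ α∈feasible , toWitness X⊆κα , sym ρ♮≡
    -- the start value n of the minimum is attained by a basic word, whose kernel is everything
    attained-by-basic : ρ♮ X ≡ n → ∃ λ α → Feasible α × X ⊆ κw α × length α ≡ ρ♮ X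
    attained-by-basic ρ♮≡n =
      let b , b-basic = extendToBasic Feasible-[]
          fb          = proj₁ b-basic
      in b , fb , ⊆κ-basic b-basic ,
         ≤-antisym (subst (length b ≤_) (sym ρ♮≡n) (Feasible⇒length≤n fb)) (ρ♮≤length fb (⊆κ-basic b-basic))

  ρ♮≡length : ∀ {X α} → Feasible α → letters α ⊆ X → X ⊆ κw α → ρ♮ X ≡ length α
  ρ♮≡length {X} {α} fα α⊆X X⊆κα =
    let β , fβ , X⊆κβ , |β|≡ = ρ♮-attained X
    in ≤-antisym (ρ♮≤length fα X⊆κα) (subst (length α ≤_) |β|≡ (⊑⇒length≤ fα fβ (⊆κ⇒⊑ fα fβ (X⊆κβ ∘ α⊆X))))

  ρ♮-monotone : ∀ X Y → X ⊆ Y → ρ♮ X ≤ ρ♮ Y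
  ρ♮-monotone X Y X⊆Y =
    let β , fβ , Y⊆κβ , |β|≡ = ρ♮-attained Y
    in subst (ρ♮ X ≤_) |β|≡ (ρ♮≤length fβ (Y⊆κβ ∘ X⊆Y))

  ρ♮-∪-∩-bound : ∀ {X Y α β} → Feasible α → X ⊆ κw α → Feasible β → Y ⊆ κw β →
                 ρ♮ (X ∪ Y) + ρ♮ (X ∩ Y) ≤ length α + length β
  ρ♮-∪-∩-bound {X} {Y} {α} {β} fα X⊆κα fβ Y⊆κβ =
    let γ , Bγ                             = basis (κw α ∩ κw β)
        fγ                                 = proj₁ Bγ
        γ-meet                             = basis-isMeet fα fβ Bγ
        δ , fδ , κα⊆κδ , κβ⊆κδ , |δ|+|γ|≤  = join fα fβ fγ (proj₁ γ-meet) (proj₁ (proj₂ γ-meet))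
        κγ≡κα∩κβ                           = kernelMeet α β γ fα fβ fγ γ-meet
    in ≤-trans (+-mono-≤ (ρ♮≤length {X ∪ Y} {δ} fδ (∪-lub (κα⊆κδ ∘ X⊆κα) (κβ⊆κδ ∘ Y⊆κβ)))
                         (ρ♮≤length {X ∩ Y} {γ} fγ (subst (X ∩ Y ⊆_) (sym κγ≡κα∩κβ) (∩-mono X⊆κα Y⊆κβ))))
               |δ|+|γ|≤

  ρ♮-submodular : ∀ X Y → ρ♮ (X ∪ Y) + ρ♮ (X ∩ Y) ≤ ρ♮ X + ρ♮ Y
  ρ♮-submodular X Y =
    let α , fα , X⊆κα , |α|≡ = ρ♮-attained X
        β , fβ , Y⊆κβ , |β|≡ = ρ♮-attained Y
    in subst (ρ♮ (X ∪ Y) + ρ♮ (X ∩ Y) ≤_) (cong₂ _+_ |α|≡ |β|≡) (ρ♮-∪-∩-bound fα X⊆κα fβ Y⊆κβ)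

  ρ♮-polymatroid : IsPolymatroidRank ρ♮
  ρ♮-polymatroid = record
    { empty      = n≤0⇒n≡0 (ρ♮≤length Feasible-[] (⊥-elim ∘ ∉⊥))
    ; monotone   = ρ♮-monotone
    ; submodular = ρ♮-submodular
    }

  κ-closed : ∀ {α} → Feasible α → IsClosed ρ♮ (κw α)
  κ-closed {α} fα = ⊆-antisym spanρ⊆κ (X⊆spanρ ρ♮ (κw α))
    where
    spanρ⊆κ : spanρ ρ♮ (κw α) ⊆ κw α
    spanρ⊆κ {y} y∈ =
      let β , fβ , ⊆κβ , |β|≡ = ρ♮-attained (κw α ∪ ⁅ y ⁆)
          |β|≡|α| = trans |β|≡ (trans (∈spanρ⁻ ρ♮ y∈) (ρ♮≡length fα (letters⊆κ fα) ⊆-refl))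
          α∼β = ⊑∧length≥⇒∼ fα fβ (κ⊆⇒⊑ fα fβ (⊆κβ ∘ p⊆p∪q ⁅ y ⁆)) (≤-reflexive |β|≡|α|)
      in subst (y ∈_) (sym (∼⇒κ≡ fα fβ α∼β)) (⊆κβ (q⊆p∪q (κw α) ⁅ y ⁆ (x∈⁅x⁆ y)))

  closed⇒κ : ∀ {X} → IsClosed ρ♮ X → ∃ λ δ → Feasible δ × κw δ ≡ X
  closed⇒κ {X} X-closed =
    let δ , fδ , X⊆κδ , |δ|≡ = ρ♮-attained X
        κδ⊆X : κw δ ⊆ X
        κδ⊆X {y} y∈κδ = subst (y ∈_) X-closed (∈spanρ⁺ ρ♮ (≤-antisym
          (subst (ρ♮ (X ∪ ⁅ y ⁆) ≤_) |δ|≡ (ρ♮≤length fδ (∪-lub X⊆κδ (⁅⁆-⊆ y∈κδ))))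
          (ρ♮-monotone X (X ∪ ⁅ y ⁆) (p⊆p∪q ⁅ y ⁆))))
    in δ , fδ , ⊆-antisym κδ⊆X X⊆κδ

module Representation {n : ℕ} {Λ : Language n} (G : IsGreedoid Λ) (normal : IsNormal Λ)
                      (kernelMeet : KernelMeetProperty Λ) (optimistic : IsOptimistic Λ) where

  open IsGreedoid G
  open Greedoid G
  open KernelMeet G kernelMeet
  open RhoNatural G normal kernelMeet

  -- Optimism makes y a continuation of a prefix u of a basic extension pxe of px. Beyond p, u ⊒ px
  -- has y ∈ κ[px] ⊆ κ[u] in its kernel, so u must be a prefix of p.
  ∈κ∷ʳ⇒∈Γ : ∀ {p x y} → Feasible p → y ∉ κw p → Feasible (p ∷ʳ x) → y ∈ κw (p ∷ʳ x) → y ∈Γ p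
  ∈κ∷ʳ⇒∈Γ {p} {x} {y} fp y∉κp fpx y∈κpx =
    let e , pxe-basic    = extendToBasic {p ∷ʳ x} fpx
        μ , fμ , _ , y∈μ = ∈kernel⁻ {letters (p ∷ʳ x)} y∈κpx
        j , _ , y∈Γu     = optimistic y (μ , fμ , y∈μ) ((p ∷ʳ x) ++ e) pxe-basic
    in continues-prefix j (subst (λ w → y ∈Γ take j w) (∷ʳ-++ p x e) y∈Γu)
    where
    continues-prefix : ∀ {e} j → y ∈Γ take j (p ++ x ∷ e) → y ∈Γ p
    continues-prefix {e} j fuy with take-++-cases j p (x ∷ e)
    ... | inj₁ (_ , u++zs≡p) = ∈Γ-prefix fp y∉κp u++zs≡p fuy
    ... | inj₂ (k , u≡pxe′)  = ⊥-elim (κ-spans fu (⊑⇒κ⊆ fpx fu px⊑u y∈κpx) fuy)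
      where
      u : Word n
      u = take j (p ++ x ∷ e)
      fu : Feasible u
      fu = hereditary u [ y ] fuy
      u≡ : u ≡ (p ∷ʳ x) ++ take k e
      u≡ = trans u≡pxe′ (sym (∷ʳ-++ p x (take k e)))
      px⊑u : p ∷ʳ x ⊑ u
      px⊑u = subst (p ∷ʳ x ⊑_) (sym u≡) (⊑-++ (take k e) (subst Feasible u≡ fu))

  ρ♮-step : ∀ {p y} → Feasible p → ρ♮ (letters (p ∷ʳ y)) ≡ suc (length p) → y ∈Γ p
  ρ♮-step {p} {y} fp ρ♮≡ =
    let α , fα , py⊆κα , |α|≡ = ρ♮-attained (letters (p ∷ʳ y))
        a , fpa , pa∼α       = ⊑⇒++∼ {p} {α} fp (⊆κ⇒⊑ fp fα (py⊆κα ∘ ∈-letters⁺ ∘ ∈-++⁺ˡ ∘ ∈-letters⁻ p))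
        y∈κpa                = subst (y ∈_) (∼⇒κ≡ {α} {p ++ a} fα fpa (∼-sym pa∼α))
                                     (py⊆κα (∈-letters⁺ (∈-∷ʳ⁺ p)))
        x , a≡[x]            = ++-length-suc p (trans (∼⇒length≡ fpa fα pa∼α) (trans |α|≡ ρ♮≡))
    in ∈κ∷ʳ⇒∈Γ fp y∉κp (subst (Feasible ∘ (p ++_)) a≡[x] fpa) (subst (λ a → y ∈ κw (p ++ a)) a≡[x] y∈κpa)
    where
    y∉κp : y ∉ κw p
    y∉κp y∈κp =
      n≮n (length p) (subst (_≤ length p) ρ♮≡ (ρ♮≤length fp (letters-∷ʳ-⊆ p (letters⊆κ fp) y∈κp)))

  ρ♮-prefixes⇒Feasible : ∀ p s → Feasible p →
                         (∀ i → i ≤ length s → ρ♮ (letters (p ++ take i s)) ≡ length p + i) → Feasible (p ++ s)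
  ρ♮-prefixes⇒Feasible p []      fp _   = subst Feasible (sym (++-identityʳ p)) fp
  ρ♮-prefixes⇒Feasible p (y ∷ s) fp ρ♮≡ =
    subst Feasible (∷ʳ-++ p y s) (ρ♮-prefixes⇒Feasible (p ∷ʳ y) s fpy ρ♮≡′)
    where
    fpy : y ∈Γ p
    fpy = ρ♮-step fp (trans (ρ♮≡ 1 (s≤s z≤n)) (+-comm (length p) 1))
    ρ♮≡′ : ∀ i → i ≤ length s → ρ♮ (letters ((p ∷ʳ y) ++ take i s)) ≡ length (p ∷ʳ y) + i
    ρ♮≡′ i i≤ = begin
      ρ♮ (letters ((p ∷ʳ y) ++ take i s))       ≡⟨ cong (ρ♮ ∘ letters) (∷ʳ-++ p y (take i s)) ⟩
      ρ♮ (letters (p ++ take (suc i) (y ∷ s)))  ≡⟨ ρ♮≡ (suc i) (s≤s i≤) ⟩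
      length p + suc i                          ≡⟨ +-suc (length p) i ⟩
      suc (length p) + i                        ≡⟨ cong (_+ i) (sym (length-∷ʳ p y)) ⟩
      length (p ∷ʳ y) + i                       ∎
      where open ≡-Reasoning

  ρ♮-represents : Represents ρ♮ Λ
  ρ♮-represents w = prefixes , ρ♮-prefixes⇒Feasible [] w Feasible-[]
    where
    prefixes : Feasible w → ∀ i → i ≤ length w → ρ♮ (letters (take i w)) ≡ i
    prefixes fw i i≤ = let fwᵢ = Feasible-take i fw in
      trans (ρ♮≡length fwᵢ ⊆-refl (letters⊆κ fwᵢ)) (trans (length-take i w) (m≤n⇒m⊓n≡m i≤))

module GaloisInsertion {n : ℕ} {Λ : Language n} (G : IsGreedoid Λ) (normal : IsNormal Λ)
                       (kernelMeet : KernelMeetProperty Λ) where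

  open Greedoid G
  open KernelMeet G kernelMeet
  open RhoNatural G normal kernelMeet

  kernel-closed : ∀ {X} → IsClosed ρ♮ X → kernel X ≡ X
  kernel-closed {X} X-closed =
    let δ , fδ , κδ≡X = closed⇒κ {X} X-closed in subst (λ Y → kernel Y ≡ Y) κδ≡X (kernel-κ {δ} fδ)

  κ∘κ⁻¹ : ∀ {X γ} → IsClosed ρ♮ X → κw γ ≡ kernel X → κw γ ≡ X
  κ∘κ⁻¹ {X} X-closed κγ≡ = trans κγ≡ (kernel-closed {X} X-closed)

  φ*-closed : ∀ α → Feasible α → IsClosed ρ♮ (spanρ ρ♮ (κw α))
  φ*-closed _ fα = cong (spanρ ρ♮) (κ-closed fα)

  φ*-monotone : ∀ α β → Feasible α → Feasible β → α ⊑ β → spanρ ρ♮ (κw α) ⊆ spanρ ρ♮ (κw β)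
  φ*-monotone _ _ fα fβ α⊑β = subst₂ _⊆_ (sym (κ-closed fα)) (sym (κ-closed fβ)) (⊑⇒κ⊆ fα fβ α⊑β)

  φ_*-exists : ∀ X → IsClosed ρ♮ X → ∃ λ γ → Feasible γ × κw γ ≡ kernel X
  φ_*-exists X _ = let γ , Bγ = basis X in γ , proj₁ Bγ , sym (kernel-basis Bγ)

  φ_*-monotone : ∀ X Y γ δ → IsClosed ρ♮ X → IsClosed ρ♮ Y → X ⊆ Y →
                 Feasible γ → κw γ ≡ kernel X → Feasible δ → κw δ ≡ kernel Y → γ ⊑ δ
  φ_*-monotone X Y γ δ X-closed Y-closed X⊆Y fγ κγ≡ fδ κδ≡ =
    κ⊆⇒⊑ fγ fδ (subst₂ _⊆_ (sym (κ∘κ⁻¹ {X} {γ} X-closed κγ≡)) (sym (κ∘κ⁻¹ {Y} {δ} Y-closed κδ≡)) X⊆Y)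

  galois : ∀ α X γ → Feasible α → IsClosed ρ♮ X → Feasible γ → κw γ ≡ kernel X →
           (spanρ ρ♮ (κw α) ⊆ X → α ⊑ γ) × (α ⊑ γ → spanρ ρ♮ (κw α) ⊆ X)
  galois α X γ fα X-closed fγ κγ≡ =
    (λ φ*α⊆X → κ⊆⇒⊑ fα fγ (subst₂ _⊆_ (κ-closed fα) (sym κγ≡X) φ*α⊆X)) ,
    (λ α⊑γ → subst₂ _⊆_ (sym (κ-closed fα)) κγ≡X (⊑⇒κ⊆ fα fγ α⊑γ))
    where
    κγ≡X : κw γ ≡ X
    κγ≡X = κ∘κ⁻¹ {X} {γ} X-closed κγ≡

  insertion : ∀ X γ → IsClosed ρ♮ X → Feasible γ → κw γ ≡ kernel X → spanρ ρ♮ (κw γ) ≡ X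
  insertion X γ X-closed fγ κγ≡ = trans (κ-closed fγ) (κ∘κ⁻¹ {X} {γ} X-closed κγ≡)

  κ-covering : ∀ {α β} → Feasible α → Feasible β → α ≺ β → _≺ρ_ ρ♮ (κw α) (κw β)
  κ-covering {α} {β} fα fβ (α⊏β , nothing-between) = ⊏⇒κ⊂ fα fβ α⊏β , λ (Z , Z-closed , κα⊂Z , Z⊂κβ) →
    let δ , fδ , κδ≡Z = closed⇒κ {Z} Z-closed in
    nothing-between (δ , fδ , κ⊂⇒⊏ fα fδ (subst (κw α ⊂_) (sym κδ≡Z) κα⊂Z)
                            , κ⊂⇒⊏ fδ fβ (subst (_⊂ κw β) (sym κδ≡Z) Z⊂κβ))

  covering : ∀ α β → Feasible α → Feasible β → α ≺ β → _≺ρ_ ρ♮ (spanρ ρ♮ (κw α)) (spanρ ρ♮ (κw β))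
  covering _ _ fα fβ α≺β = subst₂ (_≺ρ_ ρ♮) (sym (κ-closed fα)) (sym (κ-closed fβ)) (κ-covering fα fβ α≺β)

mainTheorem8 : ∀ {n : ℕ} (Λ : Language n) →
    IsGreedoid Λ → IsNormal Λ → HasIntervalProperty Λ → IsOptimistic Λ →
    KernelMeetProperty Λ → Theorem8Conclusion Λ
mainTheorem8 Λ G normal _ optimistic kernelMeet = record
  { polymatroid    = ρ♮-polymatroid
  ; representation = ρ♮-represents
  ; φ*-closed      = φ*-closed
  ; φ*-monotone    = φ*-monotone
  ; φ_*-exists     = φ_*-exists
  ; φ_*-monotone   = φ_*-monotone
  ; galois         = galois
  ; insertion      = insertion
  ; covering       = covering
  }
  where
  open RhoNatural G normal kernelMeet
  open Representation G normal kernelMeet optimistic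
  open GaloisInsertion G normal kernelMeet
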